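{- Let $(\mathbb{V},\mathbb{F},+_\mathbb{V},+_\mathbb{F},\times_\mathbb{F},\cdot)$ be a vector space, with $\mathcal{F}=\{+_\mathbb{V},+_\mathbb{F},\times_\mathbb{F},\cdot\}$, $A_0=\mathbb{F}$, $A_1=\mathbb{V}$, and let $f\in\mathrm{OT}(\mathcal{F})$. Then: (1) The only unary orderly terms over $\mathcal{F}$ are $\mathrm{id}_\mathbb{F}$ and $\mathrm{id}_\mathbb{V}$; the only binary orderly terms over $\mathcal{F}$ are the binary operations in $\mathcal{F}$. (2) If $\mathrm{dom}(f)=\mathbb{F}^n$ for some nonzero $n\in\omega$, then the range of $f$ is contained in $\mathbb{F}$. (3) If $\mathrm{dom}(f)=A_{\xi_1}\times\cdots\times A_{\xi_n}$ with $n\ge1$ and $\xi_i=1$ for some $i\le n$, then the range of $f$ is contained in $\mathbb{V}$. (4) Under the hypothesis of (3), $\xi_n=1$, i.e. $A_{\xi_n}=\mathbb{V}$. (5) If $f$ is vector-valued and all scalar components of $\bar x$ equal $0$, then $f(\bar x)$ is either the zero vector or a sum of some vectors appearing in $\bar x$; if $f$ is scalar-valued and all scalar components of $\bar x$ equal $0$, then $f(\bar x)=0$.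
   Context: The vector space is viewed as an algebra with disjoint phyla $A_0=\mathbb{F}$ and $A_1=\mathbb{V}$ and operations $+_\mathbb{V}:\mathbb{V}^2\to\mathbb{V}$, $+_\mathbb{F},\times_\mathbb{F}:\mathbb{F}^2\to\mathbb{F}$, $\cdot:\mathbb{F}\times\mathbb{V}\to\mathbb{V}$. Orderly terms $\mathrm{OT}(\mathcal{F})$: the smallest collection of functions containing $\mathcal{F}$, $\mathrm{id}_\mathbb{F}$ and $\mathrm{id}_\mathbb{V}$, and closed under: if $g\in\mathcal{F}$ is $k$-ary and $h_1,\dots,h_k$ are orderly terms whose codomains match the argument sets of $g$, then $f(\bar x_1,\dots,\bar x_k)=g(h_1(\bar x_1),\dots,h_k(\bar x_k))$ is an orderly term, where $\bar x_1,\dots,\bar x_k$ are consecutive disjoint blocks of variables. -}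

module Defs where

open import Level using (Level; suc; _⊔_)
open import Algebra.Bundles using (CommutativeRing)
open import Algebra.Module.Bundles using (Module)
open import Data.List using (List; []; _∷_; _++_)
open import Data.Bool using (Bool; true; false)
open import Data.Product using (_×_; _,_; ∃)
open import Data.Unit.Polymorphic using (⊤; tt)
open import Data.Empty.Polymorphic using (⊥)
open import Relation.Nullary using (¬_)

record VectorSpace (a ℓ : Level) : Set (suc (a ⊔ ℓ)) where
  field
    scalars : CommutativeRing a ℓ
  open CommutativeRing scalars public
  field
    0≉1     : ¬ (0# ≈ 1#)
    inverse : ∀ x → ¬ (x ≈ 0#) → ∃ λ y → x * y ≈ 1#
    vectors : Module scalars a ℓ
  open Module vectors public
    using (Carrierᴹ; _≈ᴹ_; _+ᴹ_; _*ₗ_; 0ᴹ)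

-- The two phyla: A₀ = 𝔽 (scalars), A₁ = 𝕍 (vectors).
data Sort : Set where
  𝔽 𝕍 : Sort

data Op : List Sort → Sort → Set where
  +𝕍 : Op (𝕍 ∷ 𝕍 ∷ []) 𝕍
  +𝔽 : Op (𝔽 ∷ 𝔽 ∷ []) 𝔽
  ×𝔽 : Op (𝔽 ∷ 𝔽 ∷ []) 𝔽
  ·  : Op (𝔽 ∷ 𝕍 ∷ []) 𝕍

-- Orderly terms over ℱ: identities, and g(h₁(x̄₁), h₂(x̄₂)) with g ∈ ℱ
-- (all of arity 2) and consecutive disjoint variable blocks x̄₁, x̄₂.
data OTerm : List Sort → Sort → Set where
  idt : (s : Sort) → OTerm (s ∷ []) s
  app : ∀ {a b s as bs} → Op (a ∷ b ∷ []) s → OTerm as a → OTerm bs b →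
        OTerm (as ++ bs) s

module Semantics {a ℓ : Level} (VS : VectorSpace a ℓ) where
  open VectorSpace VS

  Carrierₛ : Sort → Set a
  Carrierₛ 𝔽 = Carrier
  Carrierₛ 𝕍 = Carrierᴹ

  Eqₛ : (s : Sort) → Carrierₛ s → Carrierₛ s → Set ℓ
  Eqₛ 𝔽 = _≈_
  Eqₛ 𝕍 = _≈ᴹ_

  Args : List Sort → Set a
  Args []       = ⊤
  Args (s ∷ ss) = Carrierₛ s × Args ss

  split : ∀ as {bs} → Args (as ++ bs) → Args as × Args bs
  split []       xs       = tt , xs
  split (s ∷ as) (x , xs) with split as xs
  ... | ys , zs = (x , ys) , zs

  ⟦_⟧op : ∀ {x y s} → Op (x ∷ y ∷ []) s → Carrierₛ x → Carrierₛ y → Carrierₛ s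
  ⟦ +𝕍 ⟧op = _+ᴹ_
  ⟦ +𝔽 ⟧op = _+_
  ⟦ ×𝔽 ⟧op = _*_
  ⟦ · ⟧op  = _*ₗ_

  ⟦_⟧ : ∀ {ξs s} → OTerm ξs s → Args ξs → Carrierₛ s
  ⟦ idt s ⟧ (x , _) = x
  ⟦ app {as = as} g h₁ h₂ ⟧ xs with split as xs
  ... | ys , zs = ⟦ g ⟧op (⟦ h₁ ⟧ ys) (⟦ h₂ ⟧ zs)

  ScalarsZero : ∀ ξs → Args ξs → Set ℓ
  ScalarsZero []       _        = ⊤
  ScalarsZero (𝔽 ∷ ss) (x , xs) = (x ≈ 0#) × ScalarsZero ss xs
  ScalarsZero (𝕍 ∷ ss) (_ , xs) = ScalarsZero ss xs

  -- a choice of positions of the tuple (only vector positions matter)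
  Sel : List Sort → Set
  Sel []       = Data.Unit.Polymorphic.⊤
  Sel (_ ∷ ss) = Bool × Sel ss

  SelNonempty : ∀ ξs → Sel ξs → Set
  SelNonempty []                 _  = ⊥
  SelNonempty (𝕍 ∷ ss) (true  , _) = Data.Unit.Polymorphic.⊤
  SelNonempty (𝕍 ∷ ss) (false , b) = SelNonempty ss b
  SelNonempty (𝔽 ∷ ss) (_     , b) = SelNonempty ss b

  sumSel : ∀ ξs → Args ξs → Sel ξs → Carrierᴹ
  sumSel []       _        _          = 0ᴹ
  sumSel (𝕍 ∷ ss) (x , xs) (true , b)  = x +ᴹ sumSel ss xs b
  sumSel (𝕍 ∷ ss) (_ , xs) (false , b) = sumSel ss xs b
  sumSel (𝔽 ∷ ss) (_ , xs) (_ , b)     = sumSel ss xs b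

-- The sort of a compound
-- term is the result sort of its outermost operation, and the only operation
-- with mixed inputs, scalar multiplication, takes its vector in the last
-- argument; hence scalar-valued terms have only scalar inputs, while
-- vector-valued terms end with a vector input. Every compound term splits its
-- inputs into two nonempty blocks, so a unary term is an identity and a binary
-- term is an operation applied to two identities. When the scalar inputs are
-- 0, every scalar subterm evaluates to 0, so scalar multiplications yield the
-- zero vector and what remains of a vector-valued term is a sum of some of its
-- vector inputs; the empty sum is the zero vector.
module Submission where

open import Defs
open import Level using (Level)
open import Data.Nat using (ℕ)
open import Data.List using (List; []; _∷_; _++_; replicate; _∷ʳ_)
open import Data.List.Properties using (++-assoc; ++-conicalˡ; ++-conicalʳ; ∷-injectiveʳ)
open import Data.List.Relation.Unary.All as All using (All; []; _∷_)
import Data.List.Relation.Unary.All.Properties as All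
open import Data.List.Relation.Unary.Any using (Any; here)
import Data.List.Relation.Unary.Any.Properties as Any
open import Data.Bool using (true; false)
open import Data.Product using (Σ; ∃; _×_; _,_; proj₁; proj₂)
open import Data.Sum using (_⊎_; inj₁; inj₂)
open import Data.Unit.Polymorphic using (tt)
open import Data.Empty using (⊥-elim)
open import Relation.Nullary using (¬_)
open import Relation.Binary.PropositionalEquality as ≡
  using (_≡_; _≢_; refl; sym; subst)
import Relation.Binary.Reasoning.Setoid as SetoidReasoning

domain-nonempty : ∀ {ξs s} → OTerm ξs s → ξs ≢ []
domain-nonempty (idt s)                  ()
domain-nonempty (app {as = as} g h₁ h₂) e = domain-nonempty h₁ (++-conicalˡ as _ e)

All𝔽⇒¬Any𝕍 : ∀ {ξs} → All (_≡ 𝔽) ξs → ¬ Any (_≡ 𝕍) ξs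
All𝔽⇒¬Any𝕍 all𝔽 any𝕍 with All.lookupAny all𝔽 any𝕍
... | ξ≡𝔽 , ξ≡𝕍 with ≡.trans (sym ξ≡𝔽) ξ≡𝕍
...   | ()

𝔽-valued⇒all-inputs-𝔽 : ∀ {ξs} → OTerm ξs 𝔽 → All (_≡ 𝔽) ξs
𝔽-valued⇒all-inputs-𝔽 (idt 𝔽)        = refl ∷ []
𝔽-valued⇒all-inputs-𝔽 (app +𝔽 h₁ h₂) =
  All.++⁺ (𝔽-valued⇒all-inputs-𝔽 h₁) (𝔽-valued⇒all-inputs-𝔽 h₂)
𝔽-valued⇒all-inputs-𝔽 (app ×𝔽 h₁ h₂) =
  All.++⁺ (𝔽-valued⇒all-inputs-𝔽 h₁) (𝔽-valued⇒all-inputs-𝔽 h₂)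

𝕍-valued⇒last-input-𝕍 : ∀ {ξs} → OTerm ξs 𝕍 → ∃ λ ζs → ξs ≡ ζs ∷ʳ 𝕍
𝕍-valued⇒last-input-𝕍 (idt 𝕍) = [] , refl
𝕍-valued⇒last-input-𝕍 (app {as = as} +𝕍 h₁ h₂) with 𝕍-valued⇒last-input-𝕍 h₂
... | ζs , refl = as ++ ζs , sym (++-assoc as ζs (𝕍 ∷ []))
𝕍-valued⇒last-input-𝕍 (app {as = as} · h₁ h₂) with 𝕍-valued⇒last-input-𝕍 h₂
... | ζs , refl = as ++ ζs , sym (++-assoc as ζs (𝕍 ∷ []))

𝕍-valued⇒some-input-𝕍 : ∀ {ξs} → OTerm ξs 𝕍 → Any (_≡ 𝕍) ξs
𝕍-valued⇒some-input-𝕍 t with 𝕍-valued⇒last-input-𝕍 t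
... | ζs , refl = Any.++⁺ʳ ζs (here refl)

some-input-𝕍⇒𝕍-valued : ∀ {ξs s} → OTerm ξs s → Any (_≡ 𝕍) ξs → s ≡ 𝕍
some-input-𝕍⇒𝕍-valued {s = 𝔽} t any𝕍 = ⊥-elim (All𝔽⇒¬Any𝕍 (𝔽-valued⇒all-inputs-𝔽 t) any𝕍)
some-input-𝕍⇒𝕍-valued {s = 𝕍} t any𝕍 = refl

all-inputs-𝔽⇒𝔽-valued : ∀ {ξs s} → OTerm ξs s → All (_≡ 𝔽) ξs → s ≡ 𝔽
all-inputs-𝔽⇒𝔽-valued {s = 𝔽} t all𝔽 = refl
all-inputs-𝔽⇒𝔽-valued {s = 𝕍} t all𝔽 = ⊥-elim (All𝔽⇒¬Any𝕍 all𝔽 (𝕍-valued⇒some-input-𝕍 t))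

module Evaluation {a ℓ : Level} (VS : VectorSpace a ℓ) where
  open VectorSpace VS hiding (refl; sym)
  open Semantics VS
  open import Algebra.Module.Bundles using (Module)
  open Module vectors
    using (≈ᴹ-refl; ≈ᴹ-sym; ≈ᴹ-trans; ≈ᴹ-setoid; +ᴹ-cong; +ᴹ-assoc; +ᴹ-identityˡ; +ᴹ-identityʳ; *ₗ-cong; *ₗ-zeroˡ)

  Eqₛ-refl : ∀ s {x} → Eqₛ s x x
  Eqₛ-refl 𝔽 = VectorSpace.refl VS
  Eqₛ-refl 𝕍 = ≈ᴹ-refl

  ⟦⟧op-cong : ∀ {ξ₁ ξ₂ s} (g : Op (ξ₁ ∷ ξ₂ ∷ []) s) {x x′ y y′} →
              Eqₛ ξ₁ x x′ → Eqₛ ξ₂ y y′ → Eqₛ s (⟦ g ⟧op x y) (⟦ g ⟧op x′ y′)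
  ⟦⟧op-cong +𝕍 = +ᴹ-cong
  ⟦⟧op-cong +𝔽 = +-cong
  ⟦⟧op-cong ×𝔽 = *-cong
  ⟦⟧op-cong ·  = *ₗ-cong

  -- The domain is a general index ξs with an equation e, because a term of
  -- domain as ++ bs cannot be matched against a concrete list directly.
  unary-term-is-identity′ : ∀ {ξs ξ s} (t : OTerm ξs s) (e : ξs ≡ ξ ∷ []) →
    Σ (ξ ≡ s) λ e′ → ∀ x →
      Eqₛ s (⟦ subst (λ ζs → OTerm ζs s) e t ⟧ (x , tt)) (subst Carrierₛ e′ x)
  unary-term-is-identity′ (idt s) refl = refl , λ _ → Eqₛ-refl s
  unary-term-is-identity′ (app {as = []} g h₁ h₂) e = ⊥-elim (domain-nonempty h₁ refl)
  unary-term-is-identity′ (app {as = _ ∷ as} {bs} g h₁ h₂) e =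
    ⊥-elim (domain-nonempty h₂ (++-conicalʳ as bs (∷-injectiveʳ e)))

  unary-term-is-identity : ∀ {ξ s} (t : OTerm (ξ ∷ []) s) →
    Σ (ξ ≡ s) λ e → ∀ x → Eqₛ s (⟦ t ⟧ (x , tt)) (subst Carrierₛ e x)
  unary-term-is-identity t = unary-term-is-identity′ t refl

  binary-term-is-operation′ : ∀ {ξs ξ₁ ξ₂ s} (t : OTerm ξs s) (e : ξs ≡ ξ₁ ∷ ξ₂ ∷ []) →
    ∃ λ (g : Op (ξ₁ ∷ ξ₂ ∷ []) s) → ∀ x y →
      Eqₛ s (⟦ subst (λ ζs → OTerm ζs s) e t ⟧ (x , y , tt)) (⟦ g ⟧op x y)
  binary-term-is-operation′ (idt s) ()
  binary-term-is-operation′ (app {as = _ ∷ []} {bs = _ ∷ []} g h₁ h₂) refl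
    with unary-term-is-identity h₁ | unary-term-is-identity h₂
  ... | refl , h₁≈id | refl , h₂≈id = g , λ x y → ⟦⟧op-cong g (h₁≈id x) (h₂≈id y)
  binary-term-is-operation′ (app {as = []} g h₁ h₂) e = ⊥-elim (domain-nonempty h₁ refl)
  binary-term-is-operation′ (app {as = _ ∷ []} {bs = []} g h₁ h₂) e =
    ⊥-elim (domain-nonempty h₂ refl)
  binary-term-is-operation′ (app {as = _ ∷ []} {bs = _ ∷ _ ∷ _} g h₁ h₂) ()
  binary-term-is-operation′ (app {as = _ ∷ _ ∷ as} {bs} g h₁ h₂) e =
    ⊥-elim (domain-nonempty h₂ (++-conicalʳ as bs (∷-injectiveʳ (∷-injectiveʳ e))))

  binary-term-is-operation : ∀ {ξ₁ ξ₂ s} (t : OTerm (ξ₁ ∷ ξ₂ ∷ []) s) →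
    ∃ λ (g : Op (ξ₁ ∷ ξ₂ ∷ []) s) → ∀ x y → Eqₛ s (⟦ t ⟧ (x , y , tt)) (⟦ g ⟧op x y)
  binary-term-is-operation t = binary-term-is-operation′ t refl

  none : ∀ ξs → Sel ξs
  none []       = tt
  none (_ ∷ ξs) = false , none ξs

  _++ˢ_ : ∀ {as bs} → Sel as → Sel bs → Sel (as ++ bs)
  _++ˢ_ {[]}    _       τ = τ
  _++ˢ_ {_ ∷ _} (b , σ) τ = b , σ ++ˢ τ

  sumSel-none : ∀ ξs x → sumSel ξs x (none ξs) ≈ᴹ 0ᴹ
  sumSel-none []       x        = ≈ᴹ-refl
  sumSel-none (𝔽 ∷ ξs) (_ , xs) = sumSel-none ξs xs
  sumSel-none (𝕍 ∷ ξs) (_ , xs) = sumSel-none ξs xs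

  sumSel-++ : ∀ as {bs} x (σ : Sel as) (τ : Sel bs) →
    sumSel (as ++ bs) x (σ ++ˢ τ) ≈ᴹ
      sumSel as (proj₁ (split as x)) σ +ᴹ sumSel bs (proj₂ (split as x)) τ
  sumSel-++ []       x        σ           τ = ≈ᴹ-sym (+ᴹ-identityˡ _)
  sumSel-++ (𝔽 ∷ as) (_ , xs) (_ , σ)     τ with split as xs | sumSel-++ as xs σ τ
  ... | _ , _ | ++-sum = ++-sum
  sumSel-++ (𝕍 ∷ as) (_ , xs) (false , σ) τ with split as xs | sumSel-++ as xs σ τ
  ... | _ , _ | ++-sum = ++-sum
  sumSel-++ (𝕍 ∷ as) (v , xs) (true , σ)  τ with split as xs | sumSel-++ as xs σ τ
  ... | _ , _ | ++-sum = ≈ᴹ-trans (+ᴹ-cong ≈ᴹ-refl ++-sum) (≈ᴹ-sym (+ᴹ-assoc v _ _))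

  sumSel≈0⊎SelNonempty : ∀ ξs x (σ : Sel ξs) → sumSel ξs x σ ≈ᴹ 0ᴹ ⊎ SelNonempty ξs σ
  sumSel≈0⊎SelNonempty []       x        σ           = inj₁ ≈ᴹ-refl
  sumSel≈0⊎SelNonempty (𝔽 ∷ ξs) (_ , xs) (_ , σ)     = sumSel≈0⊎SelNonempty ξs xs σ
  sumSel≈0⊎SelNonempty (𝕍 ∷ ξs) (_ , xs) (false , σ) = sumSel≈0⊎SelNonempty ξs xs σ
  sumSel≈0⊎SelNonempty (𝕍 ∷ ξs) (_ , xs) (true , σ)  = inj₂ tt

  split-ScalarsZero : ∀ as {bs} x → ScalarsZero (as ++ bs) x →
    ScalarsZero as (proj₁ (split as x)) × ScalarsZero bs (proj₂ (split as x))
  split-ScalarsZero []       x        z        = tt , z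
  split-ScalarsZero (𝔽 ∷ as) (_ , xs) (x≈0 , z) with split as xs | split-ScalarsZero as xs z
  ... | _ , _ | z₁ , z₂ = (x≈0 , z₁) , z₂
  split-ScalarsZero (𝕍 ∷ as) (_ , xs) z with split as xs | split-ScalarsZero as xs z
  ... | _ , _ | z₁ , z₂ = z₁ , z₂

  𝔽-valued-vanishes : ∀ {ξs} (t : OTerm ξs 𝔽) x → ScalarsZero ξs x → ⟦ t ⟧ x ≈ 0#
  𝕍-valued-is-subsum : ∀ {ξs} (t : OTerm ξs 𝕍) x → ScalarsZero ξs x →
    ∃ λ σ → ⟦ t ⟧ x ≈ᴹ sumSel ξs x σ

  𝔽-valued-vanishes (idt 𝔽) _ (x≈0 , _) = x≈0
  𝔽-valued-vanishes (app {as = as} +𝔽 h₁ h₂) x z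
    with split as x | split-ScalarsZero as x z
  ... | y₁ , y₂ | z₁ , z₂ =
    trans (+-cong (𝔽-valued-vanishes h₁ y₁ z₁) (𝔽-valued-vanishes h₂ y₂ z₂)) (+-identityˡ 0#)
  𝔽-valued-vanishes (app {as = as} ×𝔽 h₁ h₂) x z
    with split as x | split-ScalarsZero as x z
  ... | y₁ , y₂ | z₁ , z₂ =
    trans (*-cong (𝔽-valued-vanishes h₁ y₁ z₁) (𝔽-valued-vanishes h₂ y₂ z₂)) (zeroˡ 0#)

  𝕍-valued-is-subsum (idt 𝕍) (v , _) _ = (true , _) , ≈ᴹ-sym (+ᴹ-identityʳ v)
  𝕍-valued-is-subsum (app {as = as} {bs} +𝕍 h₁ h₂) x z
    with split as x | split-ScalarsZero as x z | sumSel-++ as {bs} x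
  ... | y₁ , y₂ | z₁ , z₂ | ++-sum
    with 𝕍-valued-is-subsum h₁ y₁ z₁ | 𝕍-valued-is-subsum h₂ y₂ z₂
  ... | σ , h₁≈ | τ , h₂≈ = σ ++ˢ τ , ≈ᴹ-trans (+ᴹ-cong h₁≈ h₂≈) (≈ᴹ-sym (++-sum σ τ))
  𝕍-valued-is-subsum {ξs} (app {as = as} · h₁ h₂) x z
    with split as x | split-ScalarsZero as x z
  ... | y₁ , y₂ | z₁ , _ = none ξs , (begin
    ⟦ h₁ ⟧ y₁ *ₗ ⟦ h₂ ⟧ y₂  ≈⟨ *ₗ-cong (𝔽-valued-vanishes h₁ y₁ z₁) ≈ᴹ-refl ⟩
    0# *ₗ ⟦ h₂ ⟧ y₂         ≈⟨ *ₗ-zeroˡ _ ⟩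
    0ᴹ                      ≈⟨ ≈ᴹ-sym (sumSel-none ξs x) ⟩
    sumSel ξs x (none ξs)   ∎)
    where open SetoidReasoning ≈ᴹ-setoid

  𝕍-valued-is-zero-or-nonempty-subsum : ∀ {ξs} (t : OTerm ξs 𝕍) x → ScalarsZero ξs x →
    (⟦ t ⟧ x ≈ᴹ 0ᴹ) ⊎ (∃ λ σ → SelNonempty ξs σ × (⟦ t ⟧ x ≈ᴹ sumSel ξs x σ))
  𝕍-valued-is-zero-or-nonempty-subsum {ξs} t x z with 𝕍-valued-is-subsum t x z
  ... | σ , t≈sum with sumSel≈0⊎SelNonempty ξs x σ
  ... | inj₁ sum≈0 = inj₁ (≈ᴹ-trans t≈sum sum≈0)
  ... | inj₂ σ≠∅   = inj₂ (σ , σ≠∅ , t≈sum)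

lemma6p1 : ∀ {a ℓ : Level} (VS : VectorSpace a ℓ) →
  let open VectorSpace VS
      open Semantics VS
  in
  -- (1) unary orderly terms are exactly id_𝔽 and id_𝕍
  ((∀ ξ s (t : OTerm (ξ ∷ []) s) →
      Σ (ξ ≡ s) λ e → ∀ x → Eqₛ s (⟦ t ⟧ (x , tt)) (subst Carrierₛ e x))
   × (∀ ξ → ∃ λ (t : OTerm (ξ ∷ []) ξ) → ∀ x → Eqₛ ξ (⟦ t ⟧ (x , tt)) x))
  -- (1) binary orderly terms are exactly the operations of ℱ
  × ((∀ ξ₁ ξ₂ s (t : OTerm (ξ₁ ∷ ξ₂ ∷ []) s) →
        ∃ λ (g : Op (ξ₁ ∷ ξ₂ ∷ []) s) →
          ∀ x y → Eqₛ s (⟦ t ⟧ (x , y , tt)) (⟦ g ⟧op x y))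
     × (∀ ξ₁ ξ₂ s (g : Op (ξ₁ ∷ ξ₂ ∷ []) s) →
        ∃ λ (t : OTerm (ξ₁ ∷ ξ₂ ∷ []) s) →
          ∀ x y → Eqₛ s (⟦ t ⟧ (x , y , tt)) (⟦ g ⟧op x y)))
  -- (2) domain 𝔽ⁿ with n ≠ 0 ⇒ range ⊆ 𝔽
  × (∀ ξs s (t : OTerm ξs s) (n : ℕ) → n ≢ 0 →
       ξs ≡ replicate n 𝔽 → s ≡ 𝔽)
  -- (3) some ξᵢ = 1 ⇒ range ⊆ 𝕍
  × (∀ ξs s (t : OTerm ξs s) → Any (_≡ 𝕍) ξs → s ≡ 𝕍)
  -- (4) some ξᵢ = 1 ⇒ ξₙ = 1
  × (∀ ξs s (t : OTerm ξs s) → Any (_≡ 𝕍) ξs →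
       ∃ λ (ζs : List Sort) → ξs ≡ ζs ∷ʳ 𝕍)
  -- (5) vector-valued, scalars zero ⇒ zero vector or sum of some vectors of x̄
  × (∀ ξs (t : OTerm ξs 𝕍) (x : Args ξs) → ScalarsZero ξs x →
       (⟦ t ⟧ x ≈ᴹ 0ᴹ)
       ⊎ (∃ λ (σ : Sel ξs) → SelNonempty ξs σ × (⟦ t ⟧ x ≈ᴹ sumSel ξs x σ)))
  -- (5) scalar-valued, scalars zero ⇒ value 0
  × (∀ ξs (t : OTerm ξs 𝔽) (x : Args ξs) → ScalarsZero ξs x →
       ⟦ t ⟧ x ≈ 0#)
lemma6p1 VS =
  ( (λ _ _ → unary-term-is-identity)
  , (λ ξ → idt ξ , λ _ → Eqₛ-refl ξ) )
  , ( (λ _ _ _ → binary-term-is-operation)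
    , (λ ξ₁ ξ₂ s g → app g (idt ξ₁) (idt ξ₂) , λ _ _ → Eqₛ-refl s) )
  , (λ ξs s t n _ ξs≡𝔽ⁿ →
       all-inputs-𝔽⇒𝔽-valued t (subst (All (_≡ 𝔽)) (sym ξs≡𝔽ⁿ) (All.replicate⁺ n refl)))
  , (λ _ _ → some-input-𝕍⇒𝕍-valued)
  , (λ _ _ t any𝕍 → 𝕍-valued⇒last-input-𝕍 (subst (OTerm _) (some-input-𝕍⇒𝕍-valued t any𝕍) t))
  , (λ _ → 𝕍-valued-is-zero-or-nonempty-subsum)
  , (λ _ → 𝔽-valued-vanishes)
  where open Evaluation VS
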